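{- Let $R$ be an eDCTRS over a signature $\mathcal{F}$, where $\mathbb{U}(R)$ and $\mathbb{U}_{\mathrm{opt}}(R)$ use the same U symbols $U^\rho_i$. Then there exists an $\mathcal{F}$-identical tree homomorphism $\phi$ such that $\phi(\mathbb{U}(R))=\mathbb{U}_{\mathrm{opt}}(R)$ and $\phi$ is EV-preserving for $\mathbb{U}(R)$.
   Context: $\mathrm{Var}(\cdot)$ variables occurring. Extended conditional rule $\rho: l\to r\Leftarrow s_1\twoheadrightarrow t_1;\dots;s_k\twoheadrightarrow t_k$ over $\mathcal{F}$ ($l$ may be a variable); it is deterministic if $\mathrm{Var}(s_i)\subseteq\mathrm{Var}(l,t_1,\dots,t_{i-1})$; an eDCTRS is a set of deterministic such rules. For $k\ge1$: $X_i=\mathrm{Var}(l,t_1,\dots,t_{i-1})$, $Y_i=\mathrm{Var}(r,t_i,s_{i+1},t_{i+1},\dots,s_k,t_k)$, $Z_i=X_i\cap Y_i$, $\overrightarrow{X}$ a fixed listing of a finite set $X$, fresh symbols $U^\rho_1,\dots,U^\rho_k$. $\mathbb{U}(\rho)=\{l\to U^\rho_1(s_1,\overrightarrow{X_1})\}\cup\{U^\rho_i(t_i,\overrightarrow{X_i})\to U^\rho_{i+1}(s_{i+1},\overrightarrow{X_{i+1}})\mid1\le i<k\}\cup\{U^\rho_k(t_k,\overrightarrow{X_k})\to r\}$; $\mathbb{U}_{\mathrm{opt}}(\rho)$ is the same with $Z_i$ in place of $X_i$; unconditional rules kept; both extended to rule sets by union. For an unconditional rule, $\mathrm{EVar}(l\to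 r)=\mathrm{Var}(r)\setminus\mathrm{Var}(l)$. A tree homomorphism $\phi$ is determined by assigning to each $n$-ary symbol $f$ a term $\phi(f)$ over $\{x_1,\dots,x_n\}$, with $\phi(x)=x$, $\phi(f(t_1,\dots,t_n))=\phi(f)\{x_i\mapsto\phi(t_i)\}$, applied to rules and rule sets componentwise; it is $\mathcal{F}$-identical if $\phi(f)=f(x_1,\dots,x_n)$ for all $f\in\mathcal{F}$, and EV-preserving for an eTRS $S$ if $\mathrm{EVar}(\phi(l)\to\phi(r))=\mathrm{EVar}(l\to r)$ for all $l\to r\in S$. -}

module Defs where

open import Data.Nat using (ℕ; zero; suc)
open import Data.Nat.Properties using (_≟_)
open import Data.Fin using (Fin; toℕ)
open import Data.Vec using (Vec; []; _∷_; tabulate; fromList)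
import Data.Vec as Vec
open import Data.List using (List; []; _∷_; _++_; length; take; drop; concatMap; filter)
import Data.List as List
open import Data.List.Membership.Propositional using (_∈_)
open import Data.List.Membership.DecPropositional _≟_ using (_∈?_)
open import Data.List.Relation.Binary.Subset.Propositional using (_⊆_)
open import Data.List.Relation.Unary.Unique.Propositional using (Unique)
open import Data.Product using (Σ; _×_; _,_; proj₁; proj₂; ∃)
open import Data.Sum using (_⊎_; inj₁; inj₂; [_,_])
open import Relation.Nullary using (¬_)
open import Relation.Binary.PropositionalEquality using (_≡_)
open import Function.Bundles using (_⇔_)

record Sig : Set₁ where
  field
    Sym : Set
    ar  : Sym → ℕ
open Sig public

data Term (S : Sig) (V : Set) : Set where
  var : V → Term S V
  app : (f : Sym S) → Vec (Term S V) (ar S f) → Term S V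

ext : (F : Sig) (U : Set) → (U → ℕ) → Sig
ext F U a = record { Sym = Sym F ⊎ U ; ar = [ ar F , a ] }

mutual
  vars : ∀ {S V} → Term S V → List V
  vars (var x)    = x ∷ []
  vars (app f ts) = varsV ts

  varsV : ∀ {S V n} → Vec (Term S V) n → List V
  varsV []       = []
  varsV (t ∷ ts) = vars t ++ varsV ts

mutual
  emb : ∀ {F U a V} → Term F V → Term (ext F U a) V
  emb (var x)    = var x
  emb (app f ts) = app (inj₁ f) (embV ts)

  embV : ∀ {F U a V n} → Vec (Term F V) n → Vec (Term (ext F U a) V) n
  embV []       = []
  embV (t ∷ ts) = emb t ∷ embV ts

Rule : Sig → Set
Rule S = Term S ℕ × Term S ℕ

RuleSet : Sig → Set₁
RuleSet S = Rule S → Set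

EVar : ∀ {S} → Rule S → ℕ → Set
EVar (l , r) x = x ∈ vars r × ¬ (x ∈ vars l)

SameRuleSet : ∀ {S} → RuleSet S → RuleSet S → Set
SameRuleSet A B = ∀ ρ → A ρ ⇔ B ρ

Hom : Sig → Sig → Set
Hom S S' = (f : Sym S) → Term S' (Fin (ar S f))

mutual
  inst : ∀ {S V n} → Term S (Fin n) → Vec (Term S V) n → Term S V
  inst (var i)    σ = Vec.lookup σ i
  inst (app f ts) σ = app f (instV ts σ)

  instV : ∀ {S V n m} → Vec (Term S (Fin n)) m → Vec (Term S V) n → Vec (Term S V) m
  instV []       σ = []
  instV (t ∷ ts) σ = inst t σ ∷ instV ts σ

mutual
  hom : ∀ {S S' V} → Hom S S' → Term S V → Term S' V
  hom φ (var x)    = var x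
  hom φ (app f ts) = inst (φ f) (homV φ ts)

  homV : ∀ {S S' V n} → Hom S S' → Vec (Term S V) n → Vec (Term S' V) n
  homV φ []       = []
  homV φ (t ∷ ts) = hom φ t ∷ homV φ ts

homRule : ∀ {S S'} → Hom S S' → Rule S → Rule S'
homRule φ (l , r) = hom φ l , hom φ r

homRuleSet : ∀ {S S'} → Hom S S' → RuleSet S → RuleSet S'
homRuleSet φ A ρ' = ∃ λ ρ → A ρ × homRule φ ρ ≡ ρ'

FIdentical : ∀ {F U₁ a₁ U₂ a₂} → Hom (ext F U₁ a₁) (ext F U₂ a₂) → Set
FIdentical {F} φ = ∀ (f : Sym F) → φ (inj₁ f) ≡ app (inj₁ f) (tabulate var)

EVPreserving : ∀ {S S'} → Hom S S' → RuleSet S → Set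
EVPreserving φ A = ∀ ρ → A ρ → ∀ x → EVar (homRule φ ρ) x ⇔ EVar ρ x

record CRule (F : Sig) : Set where
  constructor _⇒_⇐_
  field
    lhs   : Term F ℕ
    rhs   : Term F ℕ
    conds : List (Term F ℕ × Term F ℕ)
open CRule public

module _ {F : Sig} (ρ : CRule F) where
  k : ℕ
  k = length (conds ρ)

  -- conditions indexed 0,…,k-1 (paper's index i+1)
  s : Fin k → Term F ℕ
  s i = proj₁ (List.lookup (conds ρ) i)

  t : Fin k → Term F ℕ
  t i = proj₂ (List.lookup (conds ρ) i)

  Xset : Fin k → List ℕ
  Xset i = vars (lhs ρ) ++ concatMap (λ c → vars (proj₂ c)) (take (toℕ i) (conds ρ))

  Yset : Fin k → List ℕ
  Yset i = vars (rhs ρ) ++ vars (t i)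
           ++ concatMap (λ c → vars (proj₁ c) ++ vars (proj₂ c)) (drop (suc (toℕ i)) (conds ρ))

  Zset : Fin k → List ℕ
  Zset i = filter (_∈? Yset i) (Xset i)

  Deterministic : Set
  Deterministic = ∀ (i : Fin k) → vars (s i) ⊆ Xset i

IsListing : (List ℕ → List ℕ) → Set
IsListing lst =
  (∀ xs → Unique (lst xs)) ×
  (∀ xs x → x ∈ lst xs ⇔ x ∈ xs) ×
  (∀ xs ys → (∀ x → x ∈ xs ⇔ x ∈ ys) → lst xs ≡ lst ys)

-- The unraveling, parametrised by the variable listing W ρ i used as
-- extra arguments of U^ρ_i (W = lst ∘ X for 𝕌, W = lst ∘ Z for 𝕌_opt).
-- An eDCTRS is a family R : I → CRule F; the U symbols are U^ρ_i for
-- ρ : I, i : Fin (k (R ρ)).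

module Unravel {F : Sig} {I : Set} (R : I → CRule F)
               (W : (ρ : I) → Fin (k (R ρ)) → List ℕ) where

  USym : Set
  USym = Σ I (λ ρ → Fin (k (R ρ)))

  Uar : USym → ℕ
  Uar (ρ , i) = suc (length (W ρ i))

  SigU : Sig
  SigU = ext F USym Uar

  Uterm : (ρ : I) (i : Fin (k (R ρ))) → Term SigU ℕ → Term SigU ℕ
  Uterm ρ i u = app (inj₂ (ρ , i)) (u ∷ Vec.map var (fromList (W ρ i)))

  data InU (ρ : I) : Rule SigU → Set where
    uncond : conds (R ρ) ≡ [] → InU ρ (emb (lhs (R ρ)) , emb (rhs (R ρ)))
    first  : (i : Fin (k (R ρ))) → toℕ i ≡ 0 →
             InU ρ (emb (lhs (R ρ)) , Uterm ρ i (emb (s (R ρ) i)))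
    step   : (i j : Fin (k (R ρ))) → toℕ j ≡ suc (toℕ i) →
             InU ρ (Uterm ρ i (emb (t (R ρ) i)) , Uterm ρ j (emb (s (R ρ) j)))
    final  : (i : Fin (k (R ρ))) → suc (toℕ i) ≡ k (R ρ) →
             InU ρ (Uterm ρ i (emb (t (R ρ) i)) , emb (rhs (R ρ)))

  UR : RuleSet SigU
  UR r = Σ I (λ ρ → InU ρ r)

module U    {F : Sig} {I : Set} (R : I → CRule F) (lst : List ℕ → List ℕ) =
  Unravel R (λ ρ i → lst (Xset (R ρ) i))
module Uopt {F : Sig} {I : Set} (R : I → CRule F) (lst : List ℕ → List ℕ) =
  Unravel R (λ ρ i → lst (Zset (R ρ) i))

-- The two unravelings differ only in the extra arguments of the symbols
-- U^ρ_i: U(R) passes the variables of X_i, U_opt(R) those of Z_i ⊆ X_i.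
-- So the homomorphism φ fixes every symbol of F and sends U^ρ_i(x₀,x⃗) to
-- U^ρ_i(x₀, x⃗ restricted to the positions of Z_i in the listing of X_i).
module Submission where

open import Defs
open import Data.Nat using (ℕ; zero; suc)
open import Data.Fin using (Fin; toℕ) renaming (zero to fzero; suc to fsuc)
open import Data.Vec using (Vec; []; _∷_; tabulate; fromList)
import Data.Vec as Vec
open import Data.Vec.Properties using (tabulate∘lookup)
open import Data.List using (List; []; _∷_; _++_; take; drop; concatMap)
import Data.List as List
open import Data.List.Properties using (take-suc; concatMap-++; ++-identityʳ; ++-assoc)
open import Data.List.Relation.Unary.Any using (here; there; index)
open import Data.List.Membership.Propositional using (_∈_)
open import Data.List.Membership.Propositional.Properties
  using (∈-++⁺ˡ; ∈-++⁺ʳ; ∈-++⁻; ∈-filter⁺; ∈-filter⁻)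
open import Data.List.Membership.DecPropositional Data.Nat._≟_ using (_∈?_)
open import Data.List.Relation.Binary.Subset.Propositional using (_⊆_)
open import Data.List.Relation.Binary.Subset.Propositional.Properties
  using (⊆-refl; ⊆-trans; ⊆-reflexive; ++⁺ʳ; xs⊆xs++ys; xs⊆ys++xs)
open import Data.Product using (Σ; _×_; _,_; proj₁; proj₂)
open import Data.Sum using (inj₁; inj₂; [_,_])
open import Data.Empty using (⊥-elim)
open import Function using (_∘_)
open import Function.Bundles using (_⇔_; mk⇔; Equivalence)
open import Relation.Binary.PropositionalEquality
  using (_≡_; refl; sym; trans; cong; cong₂; subst)

open Equivalence using (to; from)

++-⊆ : (xs : List ℕ) {ys zs : List ℕ} → xs ⊆ zs → ys ⊆ zs → xs ++ ys ⊆ zs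
++-⊆ xs p q m = [ p , q ] (∈-++⁻ xs m)

varVec : ∀ {S} (xs : List ℕ) → Vec (Term S ℕ) (List.length xs)
varVec xs = Vec.map var (fromList xs)

lookup-varVec : ∀ {S} {z : ℕ} {xs} (p : z ∈ xs) →
  Vec.lookup (varVec {S} xs) (index p) ≡ var z
lookup-varVec (here refl) = refl
lookup-varVec (there p)   = lookup-varVec p

varsV-varVec : ∀ {S} (xs : List ℕ) → varsV (varVec {S} xs) ≡ xs
varsV-varVec []       = refl
varsV-varVec (x ∷ xs) = cong (x ∷_) (varsV-varVec xs)

homV-varVec : ∀ {S S'} (φ : Hom S S') (xs : List ℕ) → homV φ (varVec xs) ≡ varVec xs
homV-varVec φ []       = refl
homV-varVec φ (x ∷ xs) = cong (var x ∷_) (homV-varVec φ xs)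

instV-vars : ∀ {S V n} (σ : Vec (Term S V) n) → instV (tabulate var) σ ≡ σ
instV-vars σ = trans (instV-tabulate var σ) (tabulate∘lookup σ)
  where
  instV-tabulate : ∀ {S V n m} (f : Fin m → Term S (Fin n)) (σ : Vec (Term S V) n) →
    instV (tabulate f) σ ≡ tabulate (λ i → inst (f i) σ)
  instV-tabulate {m = zero}  f σ = refl
  instV-tabulate {m = suc m} f σ = cong (inst (f fzero) σ ∷_) (instV-tabulate (f ∘ fsuc) σ)

mutual
  vars-emb : ∀ {F U a} (u : Term F ℕ) → vars (emb {F} {U} {a} u) ≡ vars u
  vars-emb (var x)    = refl
  vars-emb (app f ts) = varsV-emb ts

  varsV-emb : ∀ {F U a n} (ts : Vec (Term F ℕ) n) → varsV (embV {F} {U} {a} ts) ≡ varsV ts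
  varsV-emb []       = refl
  varsV-emb (u ∷ ts) = cong₂ _++_ (vars-emb u) (varsV-emb ts)

module _ {F U₁ a₁ U₂ a₂} (φ : Hom (ext F U₁ a₁) (ext F U₂ a₂)) (φ-id : FIdentical φ) where
  mutual
    hom-emb : ∀ {V} (u : Term F V) → hom φ (emb u) ≡ emb u
    hom-emb (var x)    = refl
    hom-emb (app f ts) rewrite φ-id f =
      cong (app (inj₁ f)) (trans (instV-vars (homV φ (embV ts))) (homV-emb ts))

    homV-emb : ∀ {V n} (ts : Vec (Term F V) n) → homV φ (embV ts) ≡ embV ts
    homV-emb []       = refl
    homV-emb (u ∷ ts) = cong₂ _∷_ (hom-emb u) (homV-emb ts)

EVar-transport : ∀ {S} {r₁ r₂ : Rule S} {P : Set} {x} → r₁ ≡ r₂ → EVar r₂ x ⇔ P → EVar r₁ x ⇔ P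
EVar-transport refl p = p

EVar-vars : ∀ {S S'} (l r : Term S ℕ) (l' r' : Term S' ℕ) {x} →
  vars l ≡ vars l' → vars r ≡ vars r' → EVar (l , r) x ⇔ EVar (l' , r') x
EVar-vars l r l' r' {x} eqL eqR = mk⇔
  (λ (m , m∉) → subst (x ∈_) eqR m , m∉ ∘ subst (x ∈_) (sym eqL))
  (λ (m , m∉) → subst (x ∈_) (sym eqR) m , m∉ ∘ subst (x ∈_) eqL)

EVar-empty : ∀ {S S'} (l r : Term S ℕ) (l' r' : Term S' ℕ) {x} →
  vars r ⊆ vars l → vars r' ⊆ vars l' → EVar (l , r) x ⇔ EVar (l' , r') x
EVar-empty l r l' r' r⊆l r'⊆l' = mk⇔ (λ (m , m∉) → ⊥-elim (m∉ (r⊆l m)))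
                                     (λ (m , m∉) → ⊥-elim (m∉ (r'⊆l' m)))

EVar-shrink-lhs : ∀ {S S'} (l r : Term S ℕ) (l' r' : Term S' ℕ) {x} →
  vars r' ≡ vars r → vars l' ⊆ vars l →
  (∀ {y} → y ∈ vars r → y ∈ vars l → y ∈ vars l') →
  EVar (l' , r') x ⇔ EVar (l , r) x
EVar-shrink-lhs l r l' r' {x} r≡ l'⊆l keep = mk⇔
  (λ (m , m∉) → subst (x ∈_) r≡ m , λ n → m∉ (keep (subst (x ∈_) r≡ m) n))
  (λ (m , m∉) → subst (x ∈_) (sym r≡) m , m∉ ∘ l'⊆l)

module _ {F : Sig} {I : Set} (R : I → CRule F) (W : (ρ : I) → Fin (k (R ρ)) → List ℕ) where
  open Unravel R W

  vars-Uterm : ∀ ρ i (u : Term F ℕ) → vars (Uterm ρ i (emb u)) ≡ vars u ++ W ρ i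
  vars-Uterm ρ i u = cong₂ _++_ (vars-emb u) (varsV-varVec (W ρ i))

module Restrict {F : Sig} {I : Set} (R : I → CRule F)
                (W W' : (ρ : I) → Fin (k (R ρ)) → List ℕ)
                (W'⊆W : ∀ ρ i → W' ρ i ⊆ W ρ i) where

  module A = Unravel R W
  module B = Unravel R W'

  select : ∀ {S} (zs xs : List ℕ) → zs ⊆ xs →
           Vec (Term S (Fin (suc (List.length xs)))) (List.length zs)
  select []       xs h = []
  select (z ∷ zs) xs h = var (fsuc (index (h (here refl)))) ∷ select zs xs (h ∘ there)

  instV-select : ∀ {S} (zs xs : List ℕ) (h : zs ⊆ xs) (u : Term S ℕ) →
    instV (select zs xs h) (u ∷ varVec xs) ≡ varVec zs
  instV-select []       xs h u = refl
  instV-select (z ∷ zs) xs h u =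
    cong₂ _∷_ (lookup-varVec (h (here refl))) (instV-select zs xs (h ∘ there) u)

  φ : Hom A.SigU B.SigU
  φ (inj₁ f)       = app (inj₁ f) (tabulate var)
  φ (inj₂ (ρ , i)) = app (inj₂ (ρ , i)) (var fzero ∷ select (W' ρ i) (W ρ i) (W'⊆W ρ i))

  φ-FIdentical : FIdentical φ
  φ-FIdentical f = refl

  φ-emb : (u : Term F ℕ) → hom φ (emb u) ≡ emb u
  φ-emb = hom-emb φ φ-FIdentical

  φ-Uterm : ∀ ρ i (u : Term F ℕ) → hom φ (A.Uterm ρ i (emb u)) ≡ B.Uterm ρ i (emb u)
  φ-Uterm ρ i u = cong₂ (λ v args → app (inj₂ (ρ , i)) (v ∷ args)) (φ-emb u) selected
    where
    selected : instV (select (W' ρ i) (W ρ i) (W'⊆W ρ i)) (hom φ (emb u) ∷ homV φ (varVec (W ρ i)))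
               ≡ varVec (W' ρ i)
    selected rewrite homV-varVec φ (W ρ i) = instV-select (W' ρ i) (W ρ i) (W'⊆W ρ i) _

  φ-InU : ∀ {ρ r} → A.InU ρ r → B.InU ρ (homRule φ r)
  φ-InU {ρ} (A.uncond e)   =
    subst (B.InU ρ) (sym (cong₂ _,_ (φ-emb _) (φ-emb _))) (B.uncond e)
  φ-InU {ρ} (A.first i e)  =
    subst (B.InU ρ) (sym (cong₂ _,_ (φ-emb _) (φ-Uterm ρ i _))) (B.first i e)
  φ-InU {ρ} (A.step i j e) =
    subst (B.InU ρ) (sym (cong₂ _,_ (φ-Uterm ρ i _) (φ-Uterm ρ j _))) (B.step i j e)
  φ-InU {ρ} (A.final i e)  =
    subst (B.InU ρ) (sym (cong₂ _,_ (φ-Uterm ρ i _) (φ-emb _))) (B.final i e)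

  φ-InU⁻ : ∀ {ρ r'} → B.InU ρ r' → Σ (Rule A.SigU) λ r → A.InU ρ r × homRule φ r ≡ r'
  φ-InU⁻ {ρ} (B.uncond e)   = _ , A.uncond e   , cong₂ _,_ (φ-emb _) (φ-emb _)
  φ-InU⁻ {ρ} (B.first i e)  = _ , A.first i e  , cong₂ _,_ (φ-emb _) (φ-Uterm ρ i _)
  φ-InU⁻ {ρ} (B.step i j e) = _ , A.step i j e , cong₂ _,_ (φ-Uterm ρ i _) (φ-Uterm ρ j _)
  φ-InU⁻ {ρ} (B.final i e)  = _ , A.final i e  , cong₂ _,_ (φ-Uterm ρ i _) (φ-emb _)

  φ-onto : SameRuleSet (homRuleSet φ A.UR) B.UR
  φ-onto r' = mk⇔
    (λ { (r , (ρ , c) , refl) → ρ , φ-InU c })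
    (λ { (ρ , c') → let (r , c , eq) = φ-InU⁻ c' in r , (ρ , c) , eq })

module _ {A : Set} (g : A → List ℕ) where

  concatMap-take-suc : (cs : List A) (i : Fin (List.length cs)) →
    concatMap g (take (suc (toℕ i)) cs) ⊆ concatMap g (take (toℕ i) cs) ++ g (List.lookup cs i)
  concatMap-take-suc cs i = ⊆-trans
    (⊆-reflexive (trans (cong (concatMap g) (take-suc cs i))
                        (concatMap-++ g (take (toℕ i) cs) (List.lookup cs i ∷ []))))
    (++⁺ʳ (concatMap g (take (toℕ i) cs)) (⊆-reflexive (++-identityʳ (g (List.lookup cs i)))))

drop-lookup : ∀ {A : Set} (cs : List A) (i : Fin (List.length cs)) →
  drop (toℕ i) cs ≡ List.lookup cs i ∷ drop (suc (toℕ i)) cs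
drop-lookup (c ∷ cs) fzero    = refl
drop-lookup (c ∷ cs) (fsuc i) = drop-lookup cs i

++-swap : (xs ys : List ℕ) → xs ++ ys ⊆ ys ++ xs
++-swap xs ys = ++-⊆ xs (xs⊆ys++xs xs ys) (xs⊆xs++ys ys xs)

-- How the variable sets X_i, Y_i, Z_i of a conditional rule evolve from
-- one condition to the next (indices shifted by one w.r.t. the paper).
module ConditionVariables {F : Sig} (ρ : CRule F) where

  X-first : ∀ i → toℕ i ≡ 0 → Xset ρ i ⊆ vars (lhs ρ)
  X-first i i≡0 = ⊆-reflexive (trans
    (cong (λ n → vars (lhs ρ) ++ concatMap (vars ∘ proj₂) (take n (conds ρ))) i≡0)
    (++-identityʳ _))

  X-step : ∀ i j → toℕ j ≡ suc (toℕ i) → Xset ρ j ⊆ vars (t ρ i) ++ Xset ρ i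
  X-step i j j≡1+i = ⊆-trans
    (⊆-reflexive (cong (λ n → vars (lhs ρ) ++ concatMap (vars ∘ proj₂) (take n (conds ρ))) j≡1+i))
    (⊆-trans (++⁺ʳ (vars (lhs ρ)) (concatMap-take-suc (vars ∘ proj₂) (conds ρ) i))
    (⊆-trans (⊆-reflexive (sym (++-assoc (vars (lhs ρ)) _ _)))
             (++-swap (Xset ρ i) (vars (t ρ i)))))

  Y-step : ∀ i j → toℕ j ≡ suc (toℕ i) → vars (s ρ j) ++ Yset ρ j ⊆ Yset ρ i
  Y-step i j j≡1+i =
    ++-⊆ (vars (s ρ j)) (later ∘ ∈-++⁺ˡ ∘ ∈-++⁺ˡ)
      (++-⊆ (vars (rhs ρ)) ∈-++⁺ˡ
        (++-⊆ (vars (t ρ j)) (later ∘ ∈-++⁺ˡ ∘ ∈-++⁺ʳ (vars (s ρ j)))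
                             (later ∘ ∈-++⁺ʳ (vars (s ρ j) ++ vars (t ρ j)))))
    where
    both : Term F ℕ × Term F ℕ → List ℕ
    both c = vars (proj₁ c) ++ vars (proj₂ c)

    suffix : drop (suc (toℕ i)) (conds ρ) ≡ List.lookup (conds ρ) j ∷ drop (suc (toℕ j)) (conds ρ)
    suffix = trans (cong (λ n → drop n (conds ρ)) (sym j≡1+i)) (drop-lookup (conds ρ) j)

    later : concatMap both (List.lookup (conds ρ) j ∷ drop (suc (toℕ j)) (conds ρ)) ⊆ Yset ρ i
    later = ∈-++⁺ʳ (vars (rhs ρ)) ∘ ∈-++⁺ʳ (vars (t ρ i))
          ∘ subst (_ ∈_) (cong (concatMap both) (sym suffix))

  rhs⊆Y : ∀ i → vars (rhs ρ) ⊆ Yset ρ i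
  rhs⊆Y i = ∈-++⁺ˡ

  Z⊆X : ∀ i → Zset ρ i ⊆ Xset ρ i
  Z⊆X i = proj₁ ∘ ∈-filter⁻ (_∈? Yset ρ i) {xs = Xset ρ i}

  Z⊆Y : ∀ i → Zset ρ i ⊆ Yset ρ i
  Z⊆Y i = proj₂ ∘ ∈-filter⁻ (_∈? Yset ρ i) {xs = Xset ρ i}

  X∩Y⊆Z : ∀ i {x} → x ∈ Xset ρ i → x ∈ Yset ρ i → x ∈ Zset ρ i
  X∩Y⊆Z i = ∈-filter⁺ (_∈? Yset ρ i)

  X∩Y-step : ∀ i j → toℕ j ≡ suc (toℕ i) →
    ∀ {x} → x ∈ Xset ρ j → x ∈ Yset ρ i → x ∈ vars (t ρ i) ++ Zset ρ i
  X∩Y-step i j j≡1+i x∈X x∈Y with ∈-++⁻ (vars (t ρ i)) (X-step i j j≡1+i x∈X)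
  ... | inj₁ x∈t = ∈-++⁺ˡ x∈t
  ... | inj₂ x∈Xi = ∈-++⁺ʳ (vars (t ρ i)) (X∩Y⊆Z i x∈Xi x∈Y)

  module _ (det : Deterministic ρ) where

    first-covered : ∀ i → toℕ i ≡ 0 → vars (s ρ i) ++ Xset ρ i ⊆ vars (lhs ρ)
    first-covered i i≡0 = X-first i i≡0 ∘ ++-⊆ (vars (s ρ i)) (det i) ⊆-refl

    step-covered-X : ∀ i j → toℕ j ≡ suc (toℕ i) →
      vars (s ρ j) ++ Xset ρ j ⊆ vars (t ρ i) ++ Xset ρ i
    step-covered-X i j j≡1+i = X-step i j j≡1+i ∘ ++-⊆ (vars (s ρ j)) (det j) ⊆-refl

    step-covered-Z : ∀ i j → toℕ j ≡ suc (toℕ i) →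
      vars (s ρ j) ++ Zset ρ j ⊆ vars (t ρ i) ++ Zset ρ i
    step-covered-Z i j j≡1+i = ++-⊆ (vars (s ρ j))
      (λ x∈s → X∩Y-step i j j≡1+i (det j x∈s) (Y-step i j j≡1+i (∈-++⁺ˡ x∈s)))
      (λ x∈Z → X∩Y-step i j j≡1+i (Z⊆X j x∈Z)
                         (Y-step i j j≡1+i (∈-++⁺ʳ (vars (s ρ j)) (Z⊆Y j x∈Z))))

module Optimisation {F : Sig} {I : Set} (R : I → CRule F) (det : ∀ ρ → Deterministic (R ρ))
                    (lst : List ℕ → List ℕ) (isL : IsListing lst) where

  WX WZ : (ρ : I) → Fin (k (R ρ)) → List ℕ
  WX ρ i = lst (Xset (R ρ) i)
  WZ ρ i = lst (Zset (R ρ) i)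

  listed : ∀ xs {x} → x ∈ lst xs ⇔ x ∈ xs
  listed xs = proj₁ (proj₂ isL) xs _

  WZ⊆WX : ∀ ρ i → WZ ρ i ⊆ WX ρ i
  WZ⊆WX ρ i = from (listed _) ∘ ConditionVariables.Z⊆X (R ρ) i ∘ to (listed _)

  open Restrict R WX WZ WZ⊆WX public

  module _ (ρ : I) (i : Fin (k (R ρ))) (u : Term F ℕ) where
    UX⊆ : vars (A.Uterm ρ i (emb u)) ⊆ vars u ++ Xset (R ρ) i
    UX⊆ = ++⁺ʳ (vars u) (to (listed _)) ∘ subst (_ ∈_) (vars-Uterm R WX ρ i u)

    ⊆UX : vars u ++ Xset (R ρ) i ⊆ vars (A.Uterm ρ i (emb u))
    ⊆UX = subst (_ ∈_) (sym (vars-Uterm R WX ρ i u)) ∘ ++⁺ʳ (vars u) (from (listed _))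

    UZ⊆ : vars (B.Uterm ρ i (emb u)) ⊆ vars u ++ Zset (R ρ) i
    UZ⊆ = ++⁺ʳ (vars u) (to (listed _)) ∘ subst (_ ∈_) (vars-Uterm R WZ ρ i u)

    ⊆UZ : vars u ++ Zset (R ρ) i ⊆ vars (B.Uterm ρ i (emb u))
    ⊆UZ = subst (_ ∈_) (sym (vars-Uterm R WZ ρ i u)) ∘ ++⁺ʳ (vars u) (from (listed _))

  -- φ preserves EVar rule by rule: unconditional rules are fixed; the first
  -- and intermediate rules have no extra variables in either unraveling;
  -- for the last one Var(r) ∩ X_k ⊆ Z_k, since Var(r) ⊆ Y_k.
  φ-EVar : ∀ {ρ r} → A.InU ρ r → ∀ x → EVar (homRule φ r) x ⇔ EVar r x
  φ-EVar {ρ} (A.uncond e) x =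
    EVar-transport (cong₂ _,_ (φ-emb l) (φ-emb r))
      (EVar-vars (emb l) (emb r) (emb l) (emb r)
                 (trans (vars-emb l) (sym (vars-emb l))) (trans (vars-emb r) (sym (vars-emb r))))
    where
    l r : Term F ℕ
    l = lhs (R ρ)
    r = rhs (R ρ)
  φ-EVar {ρ} (A.first i i≡0) x =
    EVar-transport (cong₂ _,_ (φ-emb l) (φ-Uterm ρ i sᵢ))
      (EVar-empty (emb l) (B.Uterm ρ i (emb sᵢ)) (emb l) (A.Uterm ρ i (emb sᵢ))
                  (into-lhs ∘ ++⁺ʳ (vars sᵢ) (Z⊆X i) ∘ UZ⊆ ρ i sᵢ)
                  (into-lhs ∘ UX⊆ ρ i sᵢ))
    where
    open ConditionVariables (R ρ)
    l sᵢ : Term F ℕ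
    l  = lhs (R ρ)
    sᵢ = s (R ρ) i
    into-lhs : ∀ {U a} → vars sᵢ ++ Xset (R ρ) i ⊆ vars (emb {F} {U} {a} l)
    into-lhs = subst (_ ∈_) (sym (vars-emb l)) ∘ first-covered (det ρ) i i≡0
  φ-EVar {ρ} (A.step i j j≡1+i) x =
    EVar-transport (cong₂ _,_ (φ-Uterm ρ i tᵢ) (φ-Uterm ρ j sⱼ))
      (EVar-empty (B.Uterm ρ i (emb tᵢ)) (B.Uterm ρ j (emb sⱼ))
                  (A.Uterm ρ i (emb tᵢ)) (A.Uterm ρ j (emb sⱼ))
                  (⊆UZ ρ i tᵢ ∘ step-covered-Z (det ρ) i j j≡1+i ∘ UZ⊆ ρ j sⱼ)
                  (⊆UX ρ i tᵢ ∘ step-covered-X (det ρ) i j j≡1+i ∘ UX⊆ ρ j sⱼ))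
    where
    open ConditionVariables (R ρ)
    tᵢ sⱼ : Term F ℕ
    tᵢ = t (R ρ) i
    sⱼ = s (R ρ) j
  φ-EVar {ρ} (A.final i i≡k) x =
    EVar-transport (cong₂ _,_ (φ-Uterm ρ i tᵢ) (φ-emb r))
      (EVar-shrink-lhs (A.Uterm ρ i (emb tᵢ)) (emb r) (B.Uterm ρ i (emb tᵢ)) (emb r)
                       (trans (vars-emb r) (sym (vars-emb r)))
                       (⊆UX ρ i tᵢ ∘ ++⁺ʳ (vars tᵢ) (Z⊆X i) ∘ UZ⊆ ρ i tᵢ)
                       still-needed)
    where
    open ConditionVariables (R ρ)
    tᵢ r : Term F ℕ
    tᵢ = t (R ρ) i
    r  = rhs (R ρ)
    still-needed : ∀ {y} → y ∈ vars (emb r) → y ∈ vars (A.Uterm ρ i (emb tᵢ)) →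
                   y ∈ vars (B.Uterm ρ i (emb tᵢ))
    still-needed y∈r y∈l with ∈-++⁻ (vars tᵢ) (UX⊆ ρ i tᵢ y∈l)
    ... | inj₁ y∈t = ⊆UZ ρ i tᵢ (∈-++⁺ˡ y∈t)
    ... | inj₂ y∈X =
      ⊆UZ ρ i tᵢ (∈-++⁺ʳ (vars tᵢ) (X∩Y⊆Z i y∈X (rhs⊆Y i (subst (_ ∈_) (vars-emb r) y∈r))))

lemma5p4 : (F : Sig) (I : Set) (R : I → CRule F) →
    (∀ ρ → Deterministic (R ρ)) →
    (lst : List ℕ → List ℕ) → IsListing lst →
    Σ (Hom (U.SigU R lst) (Uopt.SigU R lst)) (λ φ →
    FIdentical φ ×
    SameRuleSet (homRuleSet φ (U.UR R lst)) (Uopt.UR R lst) ×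
    EVPreserving φ (U.UR R lst))
lemma5p4 F I R det lst isL = φ , φ-FIdentical , φ-onto , λ r (ρ , c) → φ-EVar c
  where open Optimisation R det lst isL
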